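{- For every augmented integer sequence $a=(a_i)_{i\ge-1}$, the $2$-cylinder $\mathrm{cil}_2(a):=a\,\widetilde{\triangleright}\,\mathrm{cil}_2$ is defined and $\mathrm{cil}_2(a)=a\cdot\breve{\mathrm{cil}}_2$.
   Context: Sequences and matrices are indexed by $\mathbb{N}_+=\{ -1,0,1,\dots\}$; $(a\cdot B)_j=\sum_ka_kB_{k,j}$; convention $\binom{p}{q}=0$ if $p<q$ or $q<0$. $\mathrm{bin}_{i,j}=\binom{i+1}{j+1}$, $\mathrm{bin}^{ -1}_{i,j}=(-1)^{i-j}\binom{i+1}{j+1}$. For a matrix $B$ such that every column of $\mathrm{bin}^{ -1}\cdot B$ is eventually zero and any sequence $a$, $a\,\widetilde{\triangleright}\,B:=a\cdot(\mathrm{bin}^{ -1}\cdot B)$. $\breve{\mathrm{cil}}_2$ is the matrix $(\breve{\mathrm{cil}}_2)_{n,m}=\sum_{i=-1}^{n}\binom{n+1}{i+1}\binom{i+1}{m-n}$, and $\mathrm{cil}_2$ is the matrix $(\mathrm{cil}_2)_{n,m}=\sum_{j=-1}^{n}\binom{1+n}{1+j}(\breve{\mathrm{cil}}_2)_{j,m}$. -}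

module Defs where

open import Data.Nat as ℕ using (ℕ; zero; suc; _≤_; _≤ᵇ_)
open import Data.Nat.Combinatorics using (_C_)
open import Data.Integer using (ℤ; +_; _+_; _*_; -_)
open import Data.Bool using (if_then_else_)
open import Data.Product using (∃; _×_)
open import Relation.Binary.PropositionalEquality using (_≡_)

-- INDEX SHIFT: the paper indexes by {-1,0,1,...}; here paper index i
-- is represented by the natural number i+1.  So paper entry X_{i,j}
-- is  X (i+1) (j+1)  here.

Seq : Set
Seq = ℕ → ℤ

Mat : Set
Mat = ℕ → ℕ → ℤ

Σ< : ℕ → (ℕ → ℤ) → ℤ
Σ< zero    f = + 0
Σ< (suc N) f = Σ< N f + f N

Σ≤ : ℕ → (ℕ → ℤ) → ℤ
Σ≤ N f = Σ< (suc N) f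

-- binomial with convention (p choose q) = 0 if p < q (stdlib _C_ does this)
binom : ℕ → ℕ → ℤ
binom p q = + (p C q)

binomDiff : ℕ → ℕ → ℕ → ℤ
binomDiff p M N = if N ≤ᵇ M then binom p (M ℕ.∸ N) else + 0

sign : ℕ → ℤ
sign zero          = + 1
sign (suc zero)    = - (+ 1)
sign (suc (suc n)) = sign n

-- bin_{i,j} = C(i+1, j+1)   (shifted: C(I,J))
bin : Mat
bin I J = binom I J

-- bin^{-1}_{i,j} = (-1)^{i-j} C(i+1, j+1); zero unless j ≤ i
binInv : Mat
binInv I J = if J ≤ᵇ I then sign (I ℕ.∸ J) * binom I J else + 0

-- product L · B where L is lower triangular (L_{i,k} = 0 for k > i),
-- so the sum over k is finite: (L·B)_{i,j} = Σ_{k ≤ i} L_{i,k} B_{k,j}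
_⊙ₗ_ : Mat → Mat → Mat
(L ⊙ₗ B) I J = Σ≤ I (λ K → L I K * B K J)

-- breve cil_2:  Σ_{i=-1}^{n} C(n+1,i+1) C(i+1, m-n)
cilBreve2 : Mat
cilBreve2 N M = Σ≤ N (λ I → binom N I * binomDiff I M N)

-- cil_2:  Σ_{j=-1}^{n} C(1+n,1+j) (breve cil_2)_{j,m}
cil2 : Mat
cil2 N M = Σ≤ N (λ J → binom N J * cilBreve2 J M)

ColEventuallyZero : Mat → ℕ → Set
ColEventuallyZero B J = ∃ λ N → ∀ K → N ≤ K → B K J ≡ + 0

ColumnsEventuallyZero : Mat → Set
ColumnsEventuallyZero B = ∀ J → ColEventuallyZero B J

-- "a · B is defined and equals c": for each column j, the column is zero
-- from some N on, and c_j = Σ_{k<N} a_k B_{k,j} (independent of such N).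
IsDot : Seq → Mat → Seq → Set
IsDot a B c = ∀ J → ∃ λ N → (∀ K → N ≤ K → B K J ≡ + 0)
                          × (c J ≡ Σ< N (λ K → a K * B K J))

-- a ~▷ B = c : defined when all columns of bin^{-1}·B are eventually zero,
-- and then it is a · (bin^{-1} · B)
IsTildeTri : Seq → Mat → Seq → Set
IsTildeTri a B c = ColumnsEventuallyZero (binInv ⊙ₗ B) × IsDot a (binInv ⊙ₗ B) c

-- Since bin⁻¹ is lower triangular, (bin⁻¹ · cil₂) is computed row by row with
-- finite sums, and cil₂ is by definition the binomial transform of cil̆₂ taken
-- column by column. Binomial inversion therefore gives bin⁻¹ · cil₂ = cil̆₂.
-- Column j of cil̆₂ vanishes below the diagonal, so every column is
-- eventually zero and both products with a are the same finite sum.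
module Submission where

open import Defs
open import Data.Product using (∃; _×_; _,_)
open import Data.Nat as ℕ using (ℕ; zero; suc; _≤_; _<_; _∸_; _≤ᵇ_)
import Data.Nat.Properties as ℕ
open import Data.Nat.Combinatorics using (_C_; k>n⇒nCk≡0; nCk+nC[k+1]≡[n+1]C[k+1])
open import Data.Integer using (ℤ; +_; _+_; _*_; -_)
import Data.Integer.Properties as ℤ
open import Data.Integer.Tactic.RingSolver using (solve-∀)
open import Data.Bool using (true; false; T)
open import Data.Unit using (tt)
open import Data.Empty using (⊥-elim)
open import Function using (_∘_)
open import Relation.Nullary using (yes; no)
open import Relation.Binary.PropositionalEquality

open ≡-Reasoning

Σ<-cong : ∀ n {f g : ℕ → ℤ} → (∀ k → k < n → f k ≡ g k) → Σ< n f ≡ Σ< n g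
Σ<-cong zero    f≡g = refl
Σ<-cong (suc n) f≡g = cong₂ _+_ (Σ<-cong n (λ k k<n → f≡g k (ℕ.m<n⇒m<1+n k<n))) (f≡g n ℕ.≤-refl)

Σ<-zero : ∀ n (f : ℕ → ℤ) → (∀ k → k < n → f k ≡ + 0) → Σ< n f ≡ + 0
Σ<-zero zero    f f≡0 = refl
Σ<-zero (suc n) f f≡0 = cong₂ _+_ (Σ<-zero n f (λ k k<n → f≡0 k (ℕ.m<n⇒m<1+n k<n))) (f≡0 n ℕ.≤-refl)

Σ<-peel : ∀ n (f : ℕ → ℤ) → Σ< (suc n) f ≡ f 0 + Σ< n (f ∘ suc)
Σ<-peel zero    f = ℤ.+-comm (+ 0) (f 0)
Σ<-peel (suc n) f = trans (cong (_+ f (suc n)) (Σ<-peel n f)) (ℤ.+-assoc (f 0) _ _)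

Σ<-distrib-+ : ∀ n (f g : ℕ → ℤ) → Σ< n (λ k → f k + g k) ≡ Σ< n f + Σ< n g
Σ<-distrib-+ zero    f g = refl
Σ<-distrib-+ (suc n) f g =
  trans (cong (_+ (f n + g n)) (Σ<-distrib-+ n f g)) (interchange (Σ< n f) (Σ< n g) (f n) (g n))
  where
  interchange : ∀ a b c d → (a + b) + (c + d) ≡ (a + c) + (b + d)
  interchange = solve-∀

Σ<-*ˡ : ∀ n (c : ℤ) (f : ℕ → ℤ) → Σ< n (λ k → c * f k) ≡ c * Σ< n f
Σ<-*ˡ zero    c f = sym (ℤ.*-zeroʳ c)
Σ<-*ˡ (suc n) c f = trans (cong (_+ c * f n) (Σ<-*ˡ n c f)) (sym (ℤ.*-distribˡ-+ c _ _))

transform : (ℕ → ℕ → ℤ) → (ℕ → ℤ) → ℕ → ℤ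
transform w g n = Σ≤ n (λ k → w n k * g k)

transform-cong : ∀ w n {f g : ℕ → ℤ} → (∀ k → f k ≡ g k) → transform w f n ≡ transform w g n
transform-cong w n f≡g = Σ<-cong (suc n) (λ k _ → cong (w n k *_) (f≡g k))

transform-+ : ∀ w n (f g : ℕ → ℤ) → transform w (λ k → f k + g k) n ≡ transform w f n + transform w g n
transform-+ w n f g =
  trans (Σ<-cong (suc n) (λ k _ → ℤ.*-distribˡ-+ (w n k) (f k) (g k))) (Σ<-distrib-+ (suc n) _ _)

transform-zero : ∀ w g → w 0 0 ≡ + 1 → transform w g 0 ≡ g 0
transform-zero w g w₀₀≡1 =
  trans (ℤ.+-identityˡ (w 0 0 * g 0)) (trans (cong (_* g 0) w₀₀≡1) (ℤ.*-identityˡ (g 0)))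

module PascalRecurrence (w : ℕ → ℕ → ℤ) (e : ℤ)
  (w-suc-zero : ∀ n → w (suc n) 0 ≡ e * w n 0)
  (w-suc-suc : ∀ n k → w (suc n) (suc k) ≡ w n k + e * w n (suc k))
  (w-above-diagonal : ∀ n → w n (suc n) ≡ + 0) where

  transform-suc : ∀ g n → transform w g (suc n) ≡ transform w (g ∘ suc) n + e * transform w g n
  transform-suc g n = begin
      transform w g (suc n)
    ≡⟨ Σ<-peel (suc n) _ ⟩
      w (suc n) 0 * g 0 + Σ≤ n (λ k → w (suc n) (suc k) * g (suc k))
    ≡⟨ cong₂ _+_ (cong (_* g 0) (w-suc-zero n))
                 (Σ<-cong (suc n) (λ k _ → cong (_* g (suc k)) (w-suc-suc n k))) ⟩
      e * w n 0 * g 0 + Σ≤ n (λ k → (w n k + e * w n (suc k)) * g (suc k))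
    ≡⟨ cong (_+_ (e * w n 0 * g 0)) (Σ<-cong (suc n) (λ k _ → expand e (w n k) (w n (suc k)) (g (suc k)))) ⟩
      e * w n 0 * g 0 + Σ≤ n (λ k → w n k * g (suc k) + e * (w n (suc k) * g (suc k)))
    ≡⟨ cong (_+_ (e * w n 0 * g 0)) (trans (Σ<-distrib-+ (suc n) _ _) (cong (_+_ shifted) (Σ<-*ˡ (suc n) e _))) ⟩
      e * w n 0 * g 0 + (shifted + e * tail)
    ≡⟨ regroup e (w n 0) (g 0) shifted tail ⟩
      shifted + e * (w n 0 * g 0 + tail)
    ≡⟨ cong (λ x → shifted + e * x) (sym (Σ<-peel (suc n) (λ k → w n k * g k))) ⟩
      shifted + e * (transform w g n + w n (suc n) * g (suc n))
    ≡⟨ cong (λ x → shifted + e * (transform w g n + x * g (suc n))) (w-above-diagonal n) ⟩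
      shifted + e * (transform w g n + + 0 * g (suc n))
    ≡⟨ cong (λ x → shifted + e * x) (ℤ.+-identityʳ (transform w g n)) ⟩
      shifted + e * transform w g n
    ∎
    where
    shifted tail : ℤ
    shifted = transform w (g ∘ suc) n
    tail = Σ≤ n (λ k → w n (suc k) * g (suc k))
    expand : ∀ e a b x → (a + e * b) * x ≡ a * x + e * (b * x)
    expand = solve-∀
    regroup : ∀ e a x s t → e * a * x + (s + e * t) ≡ s + e * (a * x + t)
    regroup = solve-∀

binom-> : ∀ {n k} → n < k → binom n k ≡ + 0
binom-> n<k = cong +_ (k>n⇒nCk≡0 n<k)

binom-pascal : ∀ n k → binom (suc n) (suc k) ≡ binom n k + binom n (suc k)
binom-pascal n k = trans (cong +_ (sym (nCk+nC[k+1]≡[n+1]C[k+1] n k))) (ℤ.pos-+ (n C k) (n C suc k))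

module BinomialTransform = PascalRecurrence binom (+ 1)
  (λ n → refl)
  (λ n k → trans (binom-pascal n k) (cong (_+_ (binom n k)) (sym (ℤ.*-identityˡ (binom n (suc k))))))
  (λ n → binom-> (ℕ.n<1+n n))

sign-suc : ∀ n → sign (suc n) ≡ - sign n
sign-suc zero          = refl
sign-suc (suc zero)    = refl
sign-suc (suc (suc n)) = sign-suc n

-- (-1)^(n-k) C(n,k), well defined despite truncated subtraction since C(n,k) = 0 for k > n.
signedBinom : ℕ → ℕ → ℤ
signedBinom n k = sign (n ∸ k) * binom n k

signedBinom-flip : ∀ n k → sign (n ∸ k) * binom n (suc k) ≡ - (+ 1) * signedBinom n (suc k)
signedBinom-flip n k with suc k ℕ.≤? n
... | yes k<n = begin
    sign (n ∸ k) * binom n (suc k)              ≡⟨ cong (λ m → sign m * binom n (suc k)) (ℕ.+-∸-assoc 1 k<n) ⟩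
    sign (suc (n ∸ suc k)) * binom n (suc k)    ≡⟨ cong (_* binom n (suc k)) (sign-suc (n ∸ suc k)) ⟩
    - sign (n ∸ suc k) * binom n (suc k)        ≡⟨ negate (sign (n ∸ suc k)) (binom n (suc k)) ⟩
    - (+ 1) * signedBinom n (suc k)             ∎
  where
  negate : ∀ s b → - s * b ≡ - (+ 1) * (s * b)
  negate = solve-∀
... | no k≮n = begin
    sign (n ∸ k) * binom n (suc k)                ≡⟨ cong (sign (n ∸ k) *_) C≡0 ⟩
    sign (n ∸ k) * + 0                            ≡⟨ ℤ.*-zeroʳ (sign (n ∸ k)) ⟩
    + 0                                           ≡⟨ sym (ℤ.*-zeroʳ (- (+ 1))) ⟩
    - (+ 1) * + 0                                 ≡⟨ cong (- (+ 1) *_) (sym (ℤ.*-zeroʳ (sign (n ∸ suc k)))) ⟩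
    - (+ 1) * (sign (n ∸ suc k) * + 0)            ≡⟨ cong (λ x → - (+ 1) * (sign (n ∸ suc k) * x)) (sym C≡0) ⟩
    - (+ 1) * signedBinom n (suc k)               ∎
  where
  C≡0 : binom n (suc k) ≡ + 0
  C≡0 = binom-> (ℕ.≰⇒> k≮n)

signedBinom-suc-suc : ∀ n k → signedBinom (suc n) (suc k) ≡ signedBinom n k + - (+ 1) * signedBinom n (suc k)
signedBinom-suc-suc n k = begin
  sign (n ∸ k) * binom (suc n) (suc k)                           ≡⟨ cong (sign (n ∸ k) *_) (binom-pascal n k) ⟩
  sign (n ∸ k) * (binom n k + binom n (suc k))                   ≡⟨ ℤ.*-distribˡ-+ (sign (n ∸ k)) _ _ ⟩
  signedBinom n k + sign (n ∸ k) * binom n (suc k)               ≡⟨ cong (_+_ (signedBinom n k)) (signedBinom-flip n k) ⟩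
  signedBinom n k + - (+ 1) * signedBinom n (suc k)              ∎

signedBinom-suc-zero : ∀ n → signedBinom (suc n) 0 ≡ - (+ 1) * signedBinom n 0
signedBinom-suc-zero n = begin
  sign (suc n) * + 1         ≡⟨ cong (_* + 1) (sign-suc n) ⟩
  - sign n * + 1             ≡⟨ negate (sign n) ⟩
  - (+ 1) * (sign n * + 1)   ∎
  where
  negate : ∀ s → - s * + 1 ≡ - (+ 1) * (s * + 1)
  negate = solve-∀

module SignedBinomialTransform = PascalRecurrence signedBinom (- (+ 1))
  signedBinom-suc-zero
  signedBinom-suc-suc
  (λ n → trans (cong (sign (n ∸ suc n) *_) (binom-> (ℕ.n<1+n n))) (ℤ.*-zeroʳ (sign (n ∸ suc n))))

binomial-inversion : ∀ n (f : ℕ → ℤ) → transform signedBinom (transform binom f) n ≡ f n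
binomial-inversion zero    f =
  trans (transform-zero signedBinom (transform binom f) refl) (transform-zero binom f refl)
binomial-inversion (suc n) f = begin
    transform signedBinom (transform binom f) (suc n)
  ≡⟨ SignedBinomialTransform.transform-suc (transform binom f) n ⟩
    transform signedBinom (transform binom f ∘ suc) n + - (+ 1) * previous
  ≡⟨ cong (_+ - (+ 1) * previous) (trans (transform-cong signedBinom n binomial-suc) (transform-+ signedBinom n _ _)) ⟩
    (transform signedBinom (transform binom (f ∘ suc)) n + previous) + - (+ 1) * previous
  ≡⟨ cancel (transform signedBinom (transform binom (f ∘ suc)) n) previous ⟩
    transform signedBinom (transform binom (f ∘ suc)) n
  ≡⟨ binomial-inversion n (f ∘ suc) ⟩
    f (suc n)
  ∎
  where
  previous : ℤ
  previous = transform signedBinom (transform binom f) n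
  binomial-suc : ∀ k → transform binom f (suc k) ≡ transform binom (f ∘ suc) k + transform binom f k
  binomial-suc k = trans (BinomialTransform.transform-suc f k)
    (cong (_+_ (transform binom (f ∘ suc) k)) (ℤ.*-identityˡ (transform binom f k)))
  cancel : ∀ a x → (a + x) + - (+ 1) * x ≡ a
  cancel = solve-∀

binInv≡signedBinom : ∀ n k → binInv n k ≡ signedBinom n k
binInv≡signedBinom n k with k ≤ᵇ n in k≤ᵇn
... | true  = refl
-- binom n k is defined by the same test k ≤ᵇ n, so it has reduced to + 0 here.
... | false = sym (ℤ.*-zeroʳ (sign (n ∸ k)))

binInv⊙cil2≡cilBreve2 : ∀ n m → (binInv ⊙ₗ cil2) n m ≡ cilBreve2 n m
binInv⊙cil2≡cilBreve2 n m =
  trans (Σ<-cong (suc n) (λ k _ → cong (_* cil2 k m) (binInv≡signedBinom n k)))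
        (binomial-inversion n (λ j → cilBreve2 j m))

cilBreve2-below-diagonal : ∀ {n m} → m < n → cilBreve2 n m ≡ + 0
cilBreve2-below-diagonal {n} {m} m<n = Σ<-zero (suc n) _ vanish
  where
  vanish : ∀ i → i < suc n → binom n i * binomDiff i m n ≡ + 0
  vanish i _ with n ≤ᵇ m in n≤ᵇm
  ... | true  = ⊥-elim (ℕ.<⇒≱ m<n (ℕ.≤ᵇ⇒≤ n m (subst T (sym n≤ᵇm) tt)))
  ... | false = ℤ.*-zeroʳ (binom n i)

mainTheorem14 : (a : Seq) → ∃ λ c → IsTildeTri a cil2 c × IsDot a cilBreve2 c
mainTheorem14 a = c , (columns-vanish , dot-binInv⊙cil2) , dot-cilBreve2
  where
  c : Seq
  c m = Σ≤ m (λ k → a k * cilBreve2 k m)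
  vanish : ∀ m k → suc m ≤ k → (binInv ⊙ₗ cil2) k m ≡ + 0
  vanish m k m<k = trans (binInv⊙cil2≡cilBreve2 k m) (cilBreve2-below-diagonal m<k)
  columns-vanish : ColumnsEventuallyZero (binInv ⊙ₗ cil2)
  columns-vanish m = suc m , vanish m
  dot-binInv⊙cil2 : IsDot a (binInv ⊙ₗ cil2) c
  dot-binInv⊙cil2 m = suc m , vanish m ,
    Σ<-cong (suc m) (λ k _ → cong (a k *_) (sym (binInv⊙cil2≡cilBreve2 k m)))
  dot-cilBreve2 : IsDot a cilBreve2 c
  dot-cilBreve2 m = suc m , (λ k → cilBreve2-below-diagonal) , refl
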